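{- Assume the set of expansion variables is the singleton $\mathcal E=\{e_c\}$. Let $U,V\in\mathbb U$ with $d(U)=d(V)>0$. Then (1) $e_c\,U^-=U$, and (2) if $U^-=V^-$ then $U=V$.
   Context: Types. Fix a denumerably infinite set $\mathcal A$ of atomic types and a set $\mathcal E$ of expansion variables. The sets $\mathbb U$ and $\mathbb T$ are defined simultaneously by $\mathbb U::=\mathbb U\sqcap\mathbb U\mid e\,\mathbb U\ (e\in\mathcal E)\mid\mathbb T$ and $\mathbb T::=a\ (a\in\mathcal A)\mid\mathbb U\to\mathbb T$. Types are quotiented by commutativity, associativity and idempotence of $\sqcap$ and by $e(U_1\sqcap U_2)=eU_1\sqcap eU_2$. Degree: $d(a)=0$, $d(U\to T)=\min(d(U),d(T))$, $d(eU)=d(U)+1$, $d(U\sqcap V)=\min(d(U),d(V))$. For $U$ with $d(U)>0$, the type $U^-$ is defined inductively by $(U_1\sqcap U_2)^-=U_1^-\sqcap U_2^-$ and $(eU)^-=U$. -}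

module Defs where

open import Data.Nat using (ℕ; zero; suc; _⊓_; _<_; z≤n; s≤s)
open import Data.Nat.Properties using (⊓-glb; m⊓n≤m; m⊓n≤n; ≤-trans)
open import Data.Empty using (⊥-elim)
open import Relation.Binary.PropositionalEquality using (_≡_; refl)

mutual
  data 𝕌 : Set where
    _∩_  : 𝕌 → 𝕌 → 𝕌
    ec   : 𝕌 → 𝕌
    ⌞_⌟  : 𝕋 → 𝕌

  data 𝕋 : Set where
    atom : ℕ → 𝕋
    _⇒_  : 𝕌 → 𝕋 → 𝕋

infixr 6 _∩_
infixr 5 _⇒_

mutual
  data _≈U_ : 𝕌 → 𝕌 → Set where
    ≈-refl  : ∀ {U} → U ≈U U
    ≈-sym   : ∀ {U V} → U ≈U V → V ≈U U
    ≈-trans : ∀ {U V W} → U ≈U V → V ≈U W → U ≈U W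
    ∩-comm  : ∀ {U V} → (U ∩ V) ≈U (V ∩ U)
    ∩-assoc : ∀ {U V W} → ((U ∩ V) ∩ W) ≈U (U ∩ (V ∩ W))
    ∩-idem  : ∀ {U} → (U ∩ U) ≈U U
    ec-distr : ∀ {U V} → ec (U ∩ V) ≈U (ec U ∩ ec V)
    ∩-cong  : ∀ {U U' V V'} → U ≈U U' → V ≈U V' → (U ∩ V) ≈U (U' ∩ V')
    ec-cong : ∀ {U U'} → U ≈U U' → ec U ≈U ec U'
    ⌞⌟-cong : ∀ {T T'} → T ≈T T' → ⌞ T ⌟ ≈U ⌞ T' ⌟

  data _≈T_ : 𝕋 → 𝕋 → Set where
    ≈T-refl  : ∀ {T} → T ≈T T
    ≈T-sym   : ∀ {T T'} → T ≈T T' → T' ≈T T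
    ≈T-trans : ∀ {T T' T''} → T ≈T T' → T' ≈T T'' → T ≈T T''
    ⇒-cong   : ∀ {U U' T T'} → U ≈U U' → T ≈T T' → (U ⇒ T) ≈T (U' ⇒ T')

infix 4 _≈U_ _≈T_

mutual
  dU : 𝕌 → ℕ
  dU (U ∩ V) = dU U ⊓ dU V
  dU (ec U)  = suc (dU U)
  dU ⌞ T ⌟   = dT T

  dT : 𝕋 → ℕ
  dT (atom a) = 0
  dT (U ⇒ T)  = dU U ⊓ dT T

-- Helper fact: every T has degree 0 (needed to define U⁻ totally on d(U) > 0).
dT≡0 : ∀ T → dT T ≡ 0
dT≡0 (atom a) = refl
dT≡0 (U ⇒ T) with dU U | dT T | dT≡0 T
... | zero  | _ | refl = refl
... | suc _ | _ | refl = refl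

minus : (U : 𝕌) → 0 < dU U → 𝕌
minus (U ∩ V) p = minus U (≤-trans p (m⊓n≤m (dU U) (dU V)))
               ∩ minus V (≤-trans p (m⊓n≤n (dU U) (dU V)))
minus (ec U) p = U
minus ⌞ T ⌟ p with dT T | dT≡0 T
minus ⌞ T ⌟ () | .0 | refl

module Submission where

-- Positive-degree types are exactly those built from e_c U
-- by ⊓: a type of the form ⌞ T ⌟ has degree 0, so minus never reaches
-- it.  Hence, by structural induction on U, e_c U⁻ ≈ U: for e_c U the
-- two sides coincide, and for U₁ ⊓ U₂ the distributivity law
-- e(U₁⁻ ⊓ U₂⁻) ≈ e U₁⁻ ⊓ e U₂⁻ reduces to the induction hypotheses.
-- Part (2) follows from part (1) alone: if U⁻ ≈ V⁻ then
-- U ≈ e_c U⁻ ≈ e_c V⁻ ≈ V.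

open import Defs
open import Data.Nat using (_<_)
open import Data.Nat.Properties using (<-irrefl)
open import Data.Product using (_×_; _,_)
open import Relation.Binary.PropositionalEquality using (_≡_; refl; subst)

embedded-degree-not-positive : ∀ T → 0 < dU ⌞ T ⌟ → ∀ {A : Set} → A
embedded-degree-not-positive T p with () ← <-irrefl refl (subst (0 <_) (dT≡0 T) p)

ec-minus : (U : 𝕌) (p : 0 < dU U) → ec (minus U p) ≈U U
ec-minus (U ∩ V) p = ≈-trans ec-distr (∩-cong (ec-minus U _) (ec-minus V _))
ec-minus (ec U)  p = ≈-refl
ec-minus ⌞ T ⌟   p = embedded-degree-not-positive T p

minus-injective : (U V : 𝕌) (pU : 0 < dU U) (pV : 0 < dU V)
                → minus U pU ≈U minus V pV → U ≈U V
minus-injective U V pU pV U⁻≈V⁻ =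
  ≈-trans (≈-sym (ec-minus U pU)) (≈-trans (ec-cong U⁻≈V⁻) (ec-minus V pV))

lemma4 : (U V : 𝕌) → (eq : dU U ≡ dU V) → (pU : 0 < dU U) → (pV : 0 < dU V)
           → (ec (minus U pU) ≈U U) × (minus U pU ≈U minus V pV → U ≈U V)
lemma4 U V _ pU pV = ec-minus U pU , minus-injective U V pU pV
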